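{- Let $m\ge1$ and let $W=(W_1,\ldots,W_m)$ be a word in the letters $\{X,Y,Z\}$, with associated element $\rho(W)=W_1^t\cdot W_2^t\cdots W_m^t\in\mathcal M^{\otimes(m+1)}$. The coefficient of $n\otimes n\otimes\cdots\otimes n$ ($m+1$ factors) in $\rho(W)$ is nonzero if and only if $W$ satisfies: (1) $W$ contains at least one $Z$; (2) $W_1\in\{X,Z\}$; (3) $W_m\in\{X,Z\}$; (4) the first letter of $W$ different from $X$ is $Z$, and the last letter of $W$ different from $X$ is $Z$ (i.e. $W$ begins with $k\ge0$ copies of $X$ followed by $Z$ and ends with $Z$ followed by $\ell\ge0$ copies of $X$); (5) the letters $Z$ and $Y$ occur alternately in $W$ (between any two occurrences of $Z$ there is a $Y$, and between any two occurrences of $Y$ there is a $Z$). Moreover, if $W$ satisfies these conditions, this coefficient equals $1$.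
   Context: Let $\mathcal M=\mathbb Z\langle y,n\rangle/(yn=ny=n,\ n^2=0,\ y^2=y)$; as an abelian group it is free with basis $1,y,n$, so for $r\ge1$, $\mathcal M^{\otimes r}$ (over $\mathbb Z$) is free with basis the simple tensors of elements of $\{1,y,n\}$, and "coefficient" refers to this basis. Define $X^t=y\otimes n+n\otimes y$, $Y^t=y\otimes y$, $Z^t=n\otimes n\in\mathcal M^{\otimes2}$. The chaining product $\mathcal M^{\otimes r}\times\mathcal M^{\otimes s}\to\mathcal M^{\otimes(r+s-1)}$ is the bilinear (associative) map $(a_1\otimes\cdots\otimes a_r)\cdot(b_1\otimes\cdots\otimes b_s)=a_1\otimes\cdots\otimes a_{r-1}\otimes(a_rb_1)\otimes b_2\otimes\cdots\otimes b_s$; the product $W_1^t\cdot W_2^t\cdots W_m^t$ is formed with it. -}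

module Defs where

open import Data.Nat using (ℕ; zero; suc; _+_; _<_)
open import Data.Integer using (ℤ; _*_) renaming (_+_ to _+ℤ_; 0ℤ to zeroℤ; 1ℤ to oneℤ)
open import Data.Fin using (Fin; toℕ)
open import Data.Vec using (Vec; []; _∷_; lookup; toList)
open import Data.List using (List; []; _∷_; concatMap; reverse)
open import Data.Maybe using (Maybe; just; nothing)
open import Data.Product using (_×_; _,_; ∃)
open import Data.Sum using (_⊎_)
open import Relation.Binary.PropositionalEquality using (_≡_; _≢_)
open import Relation.Nullary using (yes; no)
open import Relation.Binary.Definitions using (DecidableEquality)

-- The ring M = Z<y,n>/(yn = ny = n, n^2 = 0, y^2 = y), Z-basis {1, y, n}

data B : Set where
  𝟙 y n : B

_≟B_ : DecidableEquality B
𝟙 ≟B 𝟙 = yes _≡_.refl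
𝟙 ≟B y = no λ ()
𝟙 ≟B n = no λ ()
y ≟B 𝟙 = no λ ()
y ≟B y = yes _≡_.refl
y ≟B n = no λ ()
n ≟B 𝟙 = no λ ()
n ≟B y = no λ ()
n ≟B n = yes _≡_.refl

-- product of two basis elements: either a basis element or 0 (nothing)
mulB : B → B → Maybe B
mulB 𝟙 b = just b
mulB a 𝟙 = just a
mulB y y = just y
mulB y n = just n
mulB n y = just n
mulB n n = nothing

Basis : ℕ → Set
Basis r = Vec B r

_≟V_ : ∀ {r} → DecidableEquality (Basis r)
[] ≟V [] = yes _≡_.refl
(a ∷ as) ≟V (b ∷ bs) with a ≟B b | as ≟V bs
... | yes _≡_.refl | yes _≡_.refl = yes _≡_.refl
... | no ne | _ = no λ { _≡_.refl → ne _≡_.refl }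
... | yes _ | no ne = no λ { _≡_.refl → ne _≡_.refl }

-- elements of M^{⊗r} as formal Z-linear combinations of basis tensors
Tensor : ℕ → Set
Tensor r = List (ℤ × Basis r)

coeff : ∀ {r} → Basis r → Tensor r → ℤ
coeff v [] = zeroℤ
coeff v ((c , u) ∷ ts) with u ≟V v
... | yes _ = c +ℤ coeff v ts
... | no _  = coeff v ts

-- chaining of basis tensors: a_1⊗..⊗a_{r-1}⊗(a_r b_1)⊗b_2⊗..⊗b_s
chainV : ∀ {r s} → Basis (suc r) → B → Basis s → Maybe (Basis (suc (r + s)))
chainV (a ∷ []) b bs with mulB a b
... | just c  = just (c ∷ bs)
... | nothing = nothing
chainV (a ∷ a' ∷ as) b bs with chainV (a' ∷ as) b bs
... | just v  = just (a ∷ v)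
... | nothing = nothing

_·_ : ∀ {r s} → Tensor (suc r) → Tensor (suc s) → Tensor (suc (r + s))
ts · us = concatMap (λ t → concatMap (λ u → term t u) us) ts
  where
  term : _ → _ → Tensor _
  term (c , a) (d , b ∷ bs) with chainV a b bs
  ... | just v  = (c * d , v) ∷ []
  ... | nothing = []

data Letter : Set where
  X Y Z : Letter

one : ℤ
one = oneℤ

_ᵗ : Letter → Tensor 2
X ᵗ = (one , y ∷ n ∷ []) ∷ (one , n ∷ y ∷ []) ∷ []
Y ᵗ = (one , y ∷ y ∷ []) ∷ []
Z ᵗ = (one , n ∷ n ∷ []) ∷ []

-- ρ(W) = W_1^t · W_2^t ⋯ W_m^t ∈ M^{⊗(m+1)}, for a word of length m = suc k
-- (bracketed to the right; the chaining product is associative)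
ρ : ∀ {k} → Vec Letter (suc k) → Tensor (suc (suc k))
ρ (w ∷ []) = w ᵗ
ρ (w ∷ w' ∷ ws) = (w ᵗ) · ρ (w' ∷ ws)

allN : (r : ℕ) → Basis r
allN zero = []
allN (suc r) = n ∷ allN r

firstNonX : List Letter → Maybe Letter
firstNonX [] = nothing
firstNonX (X ∷ ws) = firstNonX ws
firstNonX (w ∷ ws) = just w

headV : ∀ {k} → Vec Letter (suc k) → Letter
headV (w ∷ _) = w

lastV : ∀ {k} → Vec Letter (suc k) → Letter
lastV (w ∷ []) = w
lastV (_ ∷ w' ∷ ws) = lastV (w' ∷ ws)

Cond1 : ∀ {m} → Vec Letter m → Set
Cond1 {m} W = ∃ λ (i : Fin m) → lookup W i ≡ Z

Cond2 : ∀ {k} → Vec Letter (suc k) → Set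
Cond2 W = headV W ≡ X ⊎ headV W ≡ Z

Cond3 : ∀ {k} → Vec Letter (suc k) → Set
Cond3 W = lastV W ≡ X ⊎ lastV W ≡ Z

Cond4 : ∀ {m} → Vec Letter m → Set
Cond4 W = firstNonX (toList W) ≡ just Z × firstNonX (reverse (toList W)) ≡ just Z

Between : ∀ {m} → Vec Letter m → Letter → Letter → Set
Between {m} W a b = (i j : Fin m) → toℕ i < toℕ j → lookup W i ≡ a → lookup W j ≡ a →
  ∃ λ (l : Fin m) → toℕ i < toℕ l × toℕ l < toℕ j × lookup W l ≡ b

Cond5 : ∀ {m} → Vec Letter m → Set
Cond5 W = Between W Z Y × Between W Y Z

Conditions : ∀ {k} → Vec Letter (suc k) → Set
Conditions W = Cond1 W × Cond2 W × Cond3 W × Cond4 W × Cond5 W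

coeffN : ∀ {k} → Vec Letter (suc k) → ℤ
coeffN {k} W = coeff (allN (suc (suc k))) (ρ W)

-- Choosing one term from each Wᵢᵗ in ρ(W) = W₁ᵗ ⋯ W_mᵗ yields b ⊗ n ⊗ ⋯ ⊗ n exactly
-- when every junction product r·e is n, where r is the right factor chosen in Wᵢᵗ and e
-- the first factor of the product of the later choices. For r ∈ {y, n}, r·e = n iff
-- (r , e) is (y , n), (n , 1) or (n , y), and no term of ρ starts with 1. So, reading W from the left,
-- the first factor still to be produced is y or n and it forces the choice: X keeps it,
-- Y turns y into n, Z turns n into y, and the word must end in state y. Hence every such
-- coefficient is 0 or 1, computed by a two-state automaton, and acceptance from state n
-- says that the letters other than X read Z Y Z ⋯ Y Z: this is (4) with (5), and
-- (1)–(3) follow from (4).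
module Submission where

open import Defs
open import Data.Nat using (ℕ; zero; suc; _<_; z≤n; s≤s)
import Data.Nat as ℕ
open import Data.Fin using (Fin; zero; suc; toℕ)
open import Data.Integer using (ℤ; 0ℤ; 1ℤ; _+_; _*_)
open import Data.Integer.Properties
  using (+-identityˡ; +-identityʳ; +-assoc; *-identityˡ; *-zeroʳ; *-distribˡ-+; +-commutativeSemigroup)
open import Algebra.Properties.CommutativeSemigroup +-commutativeSemigroup using (x∙yz≈y∙xz)
open import Data.Bool using (Bool; true; false)
open import Data.Vec using (Vec; []; _∷_; toList; lookup)
open import Data.Vec.Properties using (∷-injectiveˡ)
open import Data.List using (List; []; _∷_; _++_; map; reverse)
open import Data.List.Properties using (concatMap-++; unfold-reverse)
open import Data.Maybe using (Maybe; just; nothing; _<∣>_)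
open import Data.Maybe.Properties using (<∣>-identityʳ; just-injective)
open import Data.Maybe.Relation.Unary.All using (All; just; nothing; drop-just)
open import Data.Product using (_×_; _,_; map₂; ∃)
open import Data.Sum using (_⊎_; inj₁; inj₂)
import Data.Sum as Sum
open import Data.Unit using (⊤; tt)
open import Function using (_∘_; case_of_)
open import Function.Bundles using (_⇔_; mk⇔; Equivalence)
open import Function.Construct.Composition using (_⇔-∘_)
open import Relation.Nullary using (yes; no; contradiction)
open import Relation.Binary.PropositionalEquality
open ≡-Reasoning

private variable
  r s : ℕ

coeff-++ : (v : Basis r) (ts us : Tensor r) → coeff v (ts ++ us) ≡ coeff v ts + coeff v us
coeff-++ v []             us = sym (+-identityˡ _)
coeff-++ v ((c , u) ∷ ts) us with u ≟V v
... | yes _ = trans (cong (c +_) (coeff-++ v ts us)) (sym (+-assoc c _ _))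
... | no _  = coeff-++ v ts us

coeff-miss : {u v : Basis r} (c : ℤ) (ts : Tensor r) → u ≢ v → coeff v ((c , u) ∷ ts) ≡ coeff v ts
coeff-miss {u = u} {v} c ts u≢v with u ≟V v
... | yes u≡v = contradiction u≡v u≢v
... | no _    = refl

coeff-·-++ˡ : (v : Basis (suc (r ℕ.+ s))) (ts ts' : Tensor (suc r)) (us : Tensor (suc s)) →
  coeff v ((ts ++ ts') · us) ≡ coeff v (ts · us) + coeff v (ts' · us)
coeff-·-++ˡ v ts ts' us = trans (cong (coeff v) (concatMap-++ _ ts ts')) (coeff-++ v (ts · us) (ts' · us))

_⊗_ : B → Tensor r → Tensor (suc r)
a ⊗ ts = map (map₂ (a ∷_)) ts

·-⊗ : (c : ℤ) (a : B) (as : Basis (suc r)) (T : Tensor (suc s)) →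
  ((c , a ∷ as) ∷ []) · T ≡ a ⊗ (((c , as) ∷ []) · T)
·-⊗ c a as        []                   = refl
·-⊗ c a (a' ∷ as) ((d , e ∷ bs) ∷ T) with chainV (a' ∷ as) e bs
... | just v  = cong ((c * d , a ∷ v) ∷_) (·-⊗ c a (a' ∷ as) T)
... | nothing = ·-⊗ c a (a' ∷ as) T

coeff-⊗ : (a : B) (v : Basis r) (ts : Tensor r) → coeff (a ∷ v) (a ⊗ ts) ≡ coeff v ts
coeff-⊗ a v []             = refl
-- abstracting a ≟B a as well is what lets (a ∷ u) ≟V (a ∷ v) compute
coeff-⊗ a v ((c , u) ∷ ts) with a ≟B a | u ≟V v
... | no a≢a   | _        = contradiction refl a≢a
... | yes refl | yes refl = cong (c +_) (coeff-⊗ a v ts)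
... | yes refl | no _     = coeff-⊗ a v ts

coeff-⊗-≢ : {a b : B} (v : Basis r) (ts : Tensor r) → a ≢ b → coeff (b ∷ v) (a ⊗ ts) ≡ 0ℤ
coeff-⊗-≢ v []             a≢b = refl
coeff-⊗-≢ v ((c , u) ∷ ts) a≢b = trans (coeff-miss c _ (a≢b ∘ ∷-injectiveˡ)) (coeff-⊗-≢ v ts a≢b)

coeff-·-head : (c : ℤ) (a : B) (as : Basis (suc r)) (v : Basis (suc (r ℕ.+ s))) (T : Tensor (suc s)) →
  coeff (a ∷ v) (((c , a ∷ as) ∷ []) · T) ≡ coeff v (((c , as) ∷ []) · T)
coeff-·-head c a as v T = trans (cong (coeff (a ∷ v)) (·-⊗ c a as T)) (coeff-⊗ a v (((c , as) ∷ []) · T))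

coeff-·-head-≢ : {a b : B} (c : ℤ) (as : Basis (suc r)) (v : Basis (suc (r ℕ.+ s))) (T : Tensor (suc s)) →
  a ≢ b → coeff (b ∷ v) (((c , a ∷ as) ∷ []) · T) ≡ 0ℤ
coeff-·-head-≢ {a = a} c as v T a≢b =
  trans (cong (coeff _) (·-⊗ c a as T)) (coeff-⊗-≢ v (((c , as) ∷ []) · T) a≢b)

distribˡ-step : (c d : ℤ) {x S S' : ℤ} → x ≡ c * S → d + S ≡ S' → c * d + x ≡ c * S'
distribˡ-step c d x≡cS d+S≡S' =
  trans (cong (c * d +_) x≡cS) (trans (sym (*-distribˡ-+ c d _)) (cong (c *_) d+S≡S'))

-- the sum of the coefficients of e ⊗ v over the e with a·e = n
preimageCoeff : B → Basis s → Tensor (suc s) → ℤ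
preimageCoeff n v T = coeff (𝟙 ∷ v) T + coeff (y ∷ v) T
preimageCoeff _ v T = coeff (n ∷ v) T

coeff-·-n : (c : ℤ) (a : B) (v : Basis s) (T : Tensor (suc s)) →
  coeff (n ∷ v) (((c , a ∷ []) ∷ []) · T) ≡ c * preimageCoeff a v T
coeff-·-n c 𝟙 v [] = sym (*-zeroʳ c)
coeff-·-n c y v [] = sym (*-zeroʳ c)
coeff-·-n c n v [] = sym (*-zeroʳ c)
coeff-·-n c 𝟙 v ((d , 𝟙 ∷ bs) ∷ T) = coeff-·-n c 𝟙 v T
coeff-·-n c 𝟙 v ((d , y ∷ bs) ∷ T) = coeff-·-n c 𝟙 v T
coeff-·-n c 𝟙 v ((d , n ∷ bs) ∷ T) with bs ≟V v
... | yes refl = distribˡ-step c d (coeff-·-n c 𝟙 v T) refl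
... | no _     = coeff-·-n c 𝟙 v T
coeff-·-n c y v ((d , 𝟙 ∷ bs) ∷ T) = coeff-·-n c y v T
coeff-·-n c y v ((d , y ∷ bs) ∷ T) = coeff-·-n c y v T
coeff-·-n c y v ((d , n ∷ bs) ∷ T) with bs ≟V v
... | yes refl = distribˡ-step c d (coeff-·-n c y v T) refl
... | no _     = coeff-·-n c y v T
coeff-·-n c n v ((d , 𝟙 ∷ bs) ∷ T) with bs ≟V v
... | yes refl = distribˡ-step c d (coeff-·-n c n v T) (sym (+-assoc d _ _))
... | no _     = coeff-·-n c n v T
coeff-·-n c n v ((d , y ∷ bs) ∷ T) with bs ≟V v
... | yes refl = distribˡ-step c d (coeff-·-n c n v T) (x∙yz≈y∙xz d (coeff (𝟙 ∷ v) T) (coeff (y ∷ v) T))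
... | no _     = coeff-·-n c n v T
coeff-·-n c n v ((d , n ∷ bs) ∷ T) = coeff-·-n c n v T

-- accepts b l: whether b ⊗ n ⊗ ⋯ ⊗ n occurs in ρ(l); ρ of the empty word behaves like y.
accepts : B → List Letter → Bool
accepts 𝟙 _       = false
accepts y []      = true
accepts n []      = false
accepts y (X ∷ l) = accepts y l
accepts n (X ∷ l) = accepts n l
accepts y (Y ∷ l) = accepts n l
accepts n (Y ∷ l) = false
accepts y (Z ∷ l) = false
accepts n (Z ∷ l) = accepts y l

indicator : Bool → ℤ
indicator true  = 1ℤ
indicator false = 0ℤ

indicator-spec : {z : ℤ} {P : Set} (β : Bool) → z ≡ indicator β → (β ≡ true ⇔ P) →
  (z ≢ 0ℤ ⇔ P) × (P → z ≡ 1ℤ)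
indicator-spec true  refl β⇔P = mk⇔ (λ _ → Equivalence.to β⇔P refl) (λ _ ()) , λ _ → refl
indicator-spec {P = P} false refl β⇔P = mk⇔ (λ 0≢0 → contradiction refl 0≢0) refuted , refuted
  where
  refuted : {G : Set} → P → G
  refuted p = case Equivalence.from β⇔P p of λ ()

Tracks : Tensor (suc s) → Basis s → List Letter → Set
Tracks T v l = (e : B) → coeff (e ∷ v) T ≡ indicator (accepts e l)

Tracks-ᵗ : (w : Letter) → Tracks (w ᵗ) (n ∷ []) (w ∷ [])
Tracks-ᵗ X = λ { 𝟙 → refl ; y → refl ; n → refl }
Tracks-ᵗ Y = λ { 𝟙 → refl ; y → refl ; n → refl }
Tracks-ᵗ Z = λ { 𝟙 → refl ; y → refl ; n → refl }

Tracks-ᵗ· : {T : Tensor (suc s)} {v : Basis s} {l : List Letter} (w : Letter) →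
  Tracks T v l → Tracks ((w ᵗ) · T) (n ∷ v) (w ∷ l)
Tracks-ᵗ· {T = T} {v} {l} w tr = step w
  where
  preimage-y : preimageCoeff y v T ≡ indicator (accepts n l)
  preimage-y = tr n
  preimage-n : preimageCoeff n v T ≡ indicator (accepts y l)
  preimage-n = trans (cong₂ _+_ (tr 𝟙) (tr y)) (+-identityˡ _)
  on-pair : (a₁ : B) {a₀ : B} → coeff (a₀ ∷ n ∷ v) (((one , a₀ ∷ a₁ ∷ []) ∷ []) · T) ≡ preimageCoeff a₁ v T
  on-pair a₁ {a₀} = trans (coeff-·-head one a₀ (a₁ ∷ []) (n ∷ v) T) (trans (coeff-·-n one a₁ v T) (*-identityˡ _))
  off-pair : {a₀ b : B} (a₁ : B) → a₀ ≢ b → coeff (b ∷ n ∷ v) (((one , a₀ ∷ a₁ ∷ []) ∷ []) · T) ≡ 0ℤ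
  off-pair a₁ = coeff-·-head-≢ one (a₁ ∷ []) (n ∷ v) T
  split-X : (b : B) → coeff (b ∷ n ∷ v) ((X ᵗ) · T) ≡
    coeff (b ∷ n ∷ v) (((one , y ∷ n ∷ []) ∷ []) · T) + coeff (b ∷ n ∷ v) (((one , n ∷ y ∷ []) ∷ []) · T)
  split-X b = coeff-·-++ˡ (b ∷ n ∷ v) ((one , y ∷ n ∷ []) ∷ []) ((one , n ∷ y ∷ []) ∷ []) T
  step : (w : Letter) → Tracks ((w ᵗ) · T) (n ∷ v) (w ∷ l)
  step X 𝟙 = trans (split-X 𝟙) (cong₂ _+_ (off-pair n λ ()) (off-pair y λ ()))
  step X y = trans (split-X y) (trans (cong₂ _+_ (on-pair n) (off-pair y λ ())) (trans (+-identityʳ _) preimage-n))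
  step X n = trans (split-X n) (trans (cong₂ _+_ (off-pair n λ ()) (on-pair y)) (trans (+-identityˡ _) preimage-y))
  step Y 𝟙 = off-pair y λ ()
  step Y y = trans (on-pair y) preimage-y
  step Y n = off-pair y λ ()
  step Z 𝟙 = off-pair n λ ()
  step Z y = off-pair n λ ()
  step Z n = trans (on-pair n) preimage-n

Tracks-ρ : (k : ℕ) (W : Vec Letter (suc k)) → Tracks (ρ W) (allN (suc k)) (toList W)
Tracks-ρ zero    (w ∷ [])         = Tracks-ᵗ w
Tracks-ρ (suc k) (w ∷ W@(_ ∷ _)) = Tracks-ᵗ· {T = ρ W} w (Tracks-ρ k W)

lastNonX : List Letter → Maybe Letter
lastNonX []      = nothing
lastNonX (X ∷ l) = lastNonX l
lastNonX (c ∷ l) = lastNonX l <∣> just c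

firstNonX-++ : (l l' : List Letter) → firstNonX (l ++ l') ≡ firstNonX l <∣> firstNonX l'
firstNonX-++ []      l' = refl
firstNonX-++ (X ∷ l) l' = firstNonX-++ l l'
firstNonX-++ (Y ∷ l) l' = refl
firstNonX-++ (Z ∷ l) l' = refl

lastNonX-∷ : (x : Letter) (l : List Letter) → lastNonX l <∣> firstNonX (x ∷ []) ≡ lastNonX (x ∷ l)
lastNonX-∷ X l = <∣>-identityʳ (lastNonX l)
lastNonX-∷ Y l = refl
lastNonX-∷ Z l = refl

firstNonX-reverse : (l : List Letter) → firstNonX (reverse l) ≡ lastNonX l
firstNonX-reverse []      = refl
firstNonX-reverse (x ∷ l) = begin
  firstNonX (reverse (x ∷ l))                  ≡⟨ cong firstNonX (unfold-reverse x l) ⟩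
  firstNonX (reverse l ++ x ∷ [])              ≡⟨ firstNonX-++ (reverse l) (x ∷ []) ⟩
  firstNonX (reverse l) <∣> firstNonX (x ∷ []) ≡⟨ cong (_<∣> firstNonX (x ∷ [])) (firstNonX-reverse l) ⟩
  lastNonX l <∣> firstNonX (x ∷ [])            ≡⟨ lastNonX-∷ x l ⟩
  lastNonX (x ∷ l)                             ∎

lastNonX-nothing : (l : List Letter) → firstNonX l ≡ nothing → lastNonX l ≡ nothing
lastNonX-nothing []      _ = refl
lastNonX-nothing (X ∷ l) h = lastNonX-nothing l h

Alternating : List Letter → Set
Alternating []      = ⊤
Alternating (X ∷ l) = Alternating l
Alternating (Y ∷ l) = All (_≡ Z) (firstNonX l) × Alternating l
Alternating (Z ∷ l) = All (_≡ Y) (firstNonX l) × Alternating l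

Admissible : List Letter → Set
Admissible l = firstNonX l ≡ just Z × lastNonX l ≡ just Z × Alternating l

Admissible-ZY : (l : List Letter) → Admissible l ⇔ Admissible (Z ∷ Y ∷ l)
Admissible-ZY l = mk⇔ to from
  where
  to : Admissible l → Admissible (Z ∷ Y ∷ l)
  to (first , last , alt) =
    refl , cong (λ m → (m <∣> just Y) <∣> just Z) last , just refl , subst (All (_≡ Z)) (sym first) (just refl) , alt
  last-of : lastNonX (Z ∷ Y ∷ l) ≡ just Z → lastNonX l ≡ just Z
  last-of h with lastNonX l
  ... | just _ = h
  first-of : All (_≡ Z) (firstNonX l) → lastNonX l ≡ just Z → firstNonX l ≡ just Z
  first-of all last with firstNonX l in eq
  ... | just _  = cong just (drop-just all)
  ... | nothing = case trans (sym last) (lastNonX-nothing l eq) of λ ()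
  from : Admissible (Z ∷ Y ∷ l) → Admissible l
  from (_ , last , _ , all , alt) = first-of all (last-of last) , last-of last , alt

mutual
  accepts-n⇔Admissible : (l : List Letter) → accepts n l ≡ true ⇔ Admissible l
  accepts-n⇔Admissible []      = mk⇔ (λ ()) (λ { (() , _) })
  accepts-n⇔Admissible (X ∷ l) = accepts-n⇔Admissible l
  accepts-n⇔Admissible (Y ∷ l) = mk⇔ (λ ()) (λ { (() , _) })
  accepts-n⇔Admissible (Z ∷ l) = accepts-y⇔Admissible-Z∷ l

  accepts-y⇔Admissible-Z∷ : (l : List Letter) → accepts y l ≡ true ⇔ Admissible (Z ∷ l)
  accepts-y⇔Admissible-Z∷ []      = mk⇔ (λ _ → refl , refl , nothing , tt) (λ _ → refl)
  accepts-y⇔Admissible-Z∷ (X ∷ l) = accepts-y⇔Admissible-Z∷ l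
  accepts-y⇔Admissible-Z∷ (Y ∷ l) = Admissible-ZY l ⇔-∘ accepts-n⇔Admissible l
  accepts-y⇔Admissible-Z∷ (Z ∷ l) = mk⇔ (λ ()) (λ { (_ , _ , just () , _) })

private variable
  m : ℕ
  p q x : Letter
  w : Vec Letter m

Before : Vec Letter m → Letter → Letter → Set
Before {m} w p q = (j : Fin m) → lookup w j ≡ p → ∃ λ (l : Fin m) → toℕ l < toℕ j × lookup w l ≡ q

Before-∷ : x ≢ p → Before w p q → Before (x ∷ w) p q
Before-∷ x≢p bf zero    x≡p = contradiction x≡p x≢p
Before-∷ x≢p bf (suc j) wj≡p with bf j wj≡p
... | l , l<j , wl≡q = suc l , s≤s l<j , wl≡q

Before-here : q ≢ p → Before (q ∷ w) p q
Before-here q≢p zero    q≡p = contradiction q≡p q≢p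
Before-here q≢p (suc j) _   = zero , s≤s z≤n , refl

Before-head : Before (x ∷ w) p q → x ≢ p
Before-head bf x≡p with bf zero x≡p
... | _ , () , _

Before-tail : x ≢ q → Before (x ∷ w) p q → Before w p q
Before-tail x≢q bf j wj≡p with bf (suc j) wj≡p
... | zero  , _       , x≡q  = contradiction x≡q x≢q
... | suc l , s≤s l<j , wl≡q = l , l<j , wl≡q

Between-∷ : Between w p q → (x ≡ p → Before w p q) → Between (x ∷ w) p q
Between-∷ bw bf zero    (suc j) _         x≡p  wj≡p with bf x≡p j wj≡p
... | l , l<j , wl≡q = suc l , s≤s z≤n , s≤s l<j , wl≡q
Between-∷ bw bf (suc i) (suc j) (s≤s i<j) wi≡p wj≡p with bw i j i<j wi≡p wj≡p
... | l , i<l , l<j , wl≡q = suc l , s≤s i<l , s≤s l<j , wl≡q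

Between-tail : Between (x ∷ w) p q → Between w p q
Between-tail bw i j i<j wi≡p wj≡p with bw (suc i) (suc j) (s≤s i<j) wi≡p wj≡p
... | suc l , s≤s i<l , s≤s l<j , wl≡q = l , i<l , l<j , wl≡q

Between-head : Between (p ∷ w) p q → Before w p q
Between-head bw j wj≡p with bw zero (suc j) (s≤s z≤n) refl wj≡p
... | suc l , _ , s≤s l<j , wl≡q = l , l<j , wl≡q

data Partners : Letter → Letter → Set where
  ZY : Partners Z Y
  YZ : Partners Y Z

Before⇒All : Partners p q → (w : Vec Letter m) → Before w p q → All (_≡ q) (firstNonX (toList w))
Before⇒All pq []      _  = nothing
Before⇒All ZY (X ∷ w) bf = Before⇒All ZY w (Before-tail (λ ()) bf)
Before⇒All YZ (X ∷ w) bf = Before⇒All YZ w (Before-tail (λ ()) bf)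
Before⇒All ZY (Y ∷ w) bf = just refl
Before⇒All YZ (Y ∷ w) bf = contradiction refl (Before-head bf)
Before⇒All ZY (Z ∷ w) bf = contradiction refl (Before-head bf)
Before⇒All YZ (Z ∷ w) bf = just refl

All⇒Before : Partners p q → (w : Vec Letter m) → All (_≡ q) (firstNonX (toList w)) → Before w p q
All⇒Before pq []      _           = λ ()
All⇒Before ZY (X ∷ w) all         = Before-∷ (λ ()) (All⇒Before ZY w all)
All⇒Before YZ (X ∷ w) all         = Before-∷ (λ ()) (All⇒Before YZ w all)
All⇒Before ZY (Y ∷ w) (just refl) = Before-here λ ()
All⇒Before YZ (Z ∷ w) (just refl) = Before-here λ ()
All⇒Before ZY (Z ∷ w) (just ())
All⇒Before YZ (Y ∷ w) (just ())

Cond5⇒Alternating : (w : Vec Letter m) → Cond5 w → Alternating (toList w)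
Cond5⇒Alternating []      _         = tt
Cond5⇒Alternating (X ∷ w) (bz , by) = Cond5⇒Alternating w (Between-tail bz , Between-tail by)
Cond5⇒Alternating (Y ∷ w) (bz , by) =
  Before⇒All YZ w (Between-head by) , Cond5⇒Alternating w (Between-tail bz , Between-tail by)
Cond5⇒Alternating (Z ∷ w) (bz , by) =
  Before⇒All ZY w (Between-head bz) , Cond5⇒Alternating w (Between-tail bz , Between-tail by)

Alternating⇒Cond5 : (w : Vec Letter m) → Alternating (toList w) → Cond5 w
Alternating⇒Cond5 []      _           = (λ ()) , (λ ())
Alternating⇒Cond5 (X ∷ w) alt         with Alternating⇒Cond5 w alt
... | bz , by = Between-∷ bz (λ ()) , Between-∷ by (λ ())
Alternating⇒Cond5 (Y ∷ w) (all , alt) with Alternating⇒Cond5 w alt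
... | bz , by = Between-∷ bz (λ ()) , Between-∷ by (λ _ → All⇒Before YZ w all)
Alternating⇒Cond5 (Z ∷ w) (all , alt) with Alternating⇒Cond5 w alt
... | bz , by = Between-∷ bz (λ _ → All⇒Before ZY w all) , Between-∷ by (λ ())

firstNonX-lookup : (w : Vec Letter m) → firstNonX (toList w) ≡ just p → ∃ λ (i : Fin m) → lookup w i ≡ p
firstNonX-lookup (X ∷ w) h with firstNonX-lookup w h
... | i , wi≡p = suc i , wi≡p
firstNonX-lookup (Y ∷ w) refl = zero , refl
firstNonX-lookup (Z ∷ w) refl = zero , refl

lastV≡X⊎lastNonX : {k : ℕ} (W : Vec Letter (suc k)) → lastV W ≡ X ⊎ lastNonX (toList W) ≡ just (lastV W)
lastV≡X⊎lastNonX (X ∷ [])         = inj₁ refl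
lastV≡X⊎lastNonX (Y ∷ [])         = inj₂ refl
lastV≡X⊎lastNonX (Z ∷ [])         = inj₂ refl
lastV≡X⊎lastNonX (X ∷ W@(_ ∷ _)) = lastV≡X⊎lastNonX W
lastV≡X⊎lastNonX (Y ∷ W@(_ ∷ _)) = Sum.map₂ (cong (_<∣> just Y)) (lastV≡X⊎lastNonX W)
lastV≡X⊎lastNonX (Z ∷ W@(_ ∷ _)) = Sum.map₂ (cong (_<∣> just Z)) (lastV≡X⊎lastNonX W)

Admissible⇔Conditions : {k : ℕ} (W : Vec Letter (suc k)) → Admissible (toList W) ⇔ Conditions W
Admissible⇔Conditions W = mk⇔ to from
  where
  cond2 : {k : ℕ} (W : Vec Letter (suc k)) → firstNonX (toList W) ≡ just Z → Cond2 W
  cond2 (X ∷ _) _ = inj₁ refl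
  cond2 (Z ∷ _) _ = inj₂ refl
  cond3 : lastNonX (toList W) ≡ just Z → Cond3 W
  cond3 last = Sum.map₂ (λ h → just-injective (trans (sym h) last)) (lastV≡X⊎lastNonX W)
  to : Admissible (toList W) → Conditions W
  to (first , last , alt) =
    firstNonX-lookup W first , cond2 W first , cond3 last ,
    (first , trans (firstNonX-reverse (toList W)) last) , Alternating⇒Cond5 W alt
  from : Conditions W → Admissible (toList W)
  from (_ , _ , _ , (first , last) , c5) =
    first , trans (sym (firstNonX-reverse (toList W))) last , Cond5⇒Alternating W c5

lemma4p9 : (k : ℕ) (W : Vec Letter (suc k)) →
    (coeffN W ≢ 0ℤ ⇔ Conditions W) × (Conditions W → coeffN W ≡ 1ℤ)
lemma4p9 k W = indicator-spec (accepts n (toList W)) (Tracks-ρ k W n) accepts⇔Conditions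
  where
  accepts⇔Conditions : accepts n (toList W) ≡ true ⇔ Conditions W
  accepts⇔Conditions = Admissible⇔Conditions W ⇔-∘ accepts-n⇔Admissible (toList W)
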